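{- Let $G$ be a sudoku solution grid, let $U\subset G$ be an unavoidable set of degree $k$ with $m$ elements, and let $V\subset G$ be an unavoidable set of degree $\ell$ with $n$ elements such that $U\cap V=\emptyset$. Then $U\cup V$ is an unavoidable set of degree $k+\ell$ with $m+n$ elements.
   Context: A sudoku solution grid is regarded as a function $\{0,\dots,80\}\to\{1,\dots,9\}$ satisfying the sudoku rules (each row, column and $3\times3$ box contains each digit exactly once), identified with its graph, a subset of $\{0,\dots,80\}\times\{1,\dots,9\}$. A completion of $X\subseteq G$ is a solution grid containing $X$. A subset $X\subseteq G$ is unavoidable (= unavoidable of degree 1) if $G\setminus X$ has more than one completion. Recursively, a nonempty subset $U\subseteq G$ is an unavoidable set of degree $k>1$ if for every $c\in U$ the set $U\setminus\{c\}$ is an unavoidable set of degree $k-1$. -}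

module Defs where

open import Data.Nat using (ℕ; zero; suc)
open import Data.Fin using (Fin; combine)
open import Data.Fin.Subset using (Subset; _∈_; _-_; Nonempty)
open import Data.Product using (Σ; ∃; ∃!; _×_)
open import Relation.Binary.PropositionalEquality using (_≡_; _≢_)
open import Data.Empty using (⊥)

-- Cells 0..80 are Fin 81; cell (r , c) (row r, column c, both Fin 9)
-- is the index 9*r + c  (Data.Fin.combine is row-major).
-- Digits 1..9 are represented by Fin 9 (digit d+1 ↔ d).
Cell : Set
Cell = Fin 81

Digit : Set
Digit = Fin 9

Grid : Set
Grid = Cell → Digit

cellAt : Fin 9 → Fin 9 → Cell
cellAt r c = combine r c

rowCell : Fin 9 → Fin 9 → Cell
rowCell r p = cellAt r p

colCell : Fin 9 → Fin 9 → Cell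
colCell c p = cellAt p c

-- box  combine br bc  (band br, stack bc), position  combine pr pc
boxCell : Fin 3 → Fin 3 → Fin 3 → Fin 3 → Cell
boxCell br bc pr pc = cellAt (combine br pr) (combine bc pc)

ExactlyOnce : Grid → (Fin 9 → Cell) → Set
ExactlyOnce g grp = ∀ (d : Digit) → ∃! _≡_ (λ p → g (grp p) ≡ d)

IsSolution : Grid → Set
IsSolution g =
  (∀ r → ExactlyOnce g (rowCell r)) ×
  (∀ c → ExactlyOnce g (colCell c)) ×
  (∀ br bc → ExactlyOnce g (λ p → boxCell br bc (Data.Fin.quotient 3 p) (Data.Fin.remainder {3} 3 p)))

-- A subset X of the graph of G is determined by its set of cells;
-- we represent X ⊆ G by S : Subset 81, X = {(c , G c) | c ∈ S}.
IsCompletionOfComplement : Grid → Subset 81 → Grid → Set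
IsCompletionOfComplement G S H = IsSolution H × (∀ c → ¬∈ c → H c ≡ G c)
  where
  ¬∈ : Cell → Set
  ¬∈ c = c ∈ S → ⊥

Unavoidable : Grid → Subset 81 → Set
Unavoidable G S =
  Σ Grid λ H₁ → Σ Grid λ H₂ →
    IsCompletionOfComplement G S H₁ × IsCompletionOfComplement G S H₂ ×
    ∃ (λ c → H₁ c ≢ H₂ c)

-- unavoidable of degree k (degree 0 is not defined, rendered as ⊥)
UnavoidableOfDegree : ℕ → Grid → Subset 81 → Set
UnavoidableOfDegree zero G S = ⊥
UnavoidableOfDegree (suc zero) G S = Unavoidable G S
UnavoidableOfDegree (suc (suc k)) G S =
  Nonempty S × (∀ c → c ∈ S → UnavoidableOfDegree (suc k) G (S - c))

module Submission where

-- The argument never uses the sudoku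
-- rules: it only uses that a completion of G ∖ S is a completion of G ∖ T
-- whenever S ⊆ T.

open import Defs
open import Data.Nat using (ℕ; _+_; _≤_)
open import Data.Fin.Subset using (Subset; _∩_; _∪_; ∣_∣; Empty)
open import Data.Product using (_×_)
open import Relation.Binary.PropositionalEquality using (_≡_)

open import Data.Nat using (zero; suc; s≤s; z≤n)
open import Data.Nat.Properties using (+-suc; +-comm)
open import Data.Fin using (Fin)
open import Data.Fin.Subset using (_∈_; _∉_; _⊆_; _-_; _─_; Nonempty; ⁅_⁆; inside; outside)
open import Data.Fin.Subset.Properties
  using (_∈?_; ∩-comm; ∪-comm; ⊆-trans; p─q⊆p; p⊆p∪q; q⊆p∪q; x∈p∧x≢y⇒x∈p-y;
         x∈p∪q⁻; x∈p∩q⁺; x∈p∩q⁻; x∈⁅x⁆; drop-∷-Empty)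
open import Data.Vec using ([]; _∷_)
open import Data.Vec.Base using (here; there)
open import Data.Product using (_,_; proj₁; proj₂)
open import Data.Sum using ([_,_])
open import Data.Empty using (⊥-elim)
open import Relation.Nullary using (yes; no)
open import Relation.Binary.PropositionalEquality using (refl; sym; trans; cong; subst; subst₂)

private
  variable
    n : ℕ
    p q : Subset n
    x y : Fin n

x∈p─q⇒x∉q : ∀ (p q : Subset n) → x ∈ p ─ q → x ∉ q
x∈p─q⇒x∉q (inside ∷ p) (outside ∷ q) here      ()
x∈p─q⇒x∉q (_ ∷ p)      (_ ∷ q)       (there h) (there h') = x∈p─q⇒x∉q p q h h'

delete-monotone : p ⊆ q → p - y ⊆ q - y
delete-monotone {p = p} {y = y} p⊆q x∈p-y =
  x∈p∧x≢y⇒x∈p-y (p⊆q (p─q⊆p p ⁅ y ⁆ x∈p-y))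
                (λ { refl → x∈p─q⇒x∉q p ⁅ y ⁆ x∈p-y (x∈⁅x⁆ y) })

⊆-delete-absent : y ∉ p → p ⊆ q → p ⊆ q - y
⊆-delete-absent y∉p p⊆q x∈p = x∈p∧x≢y⇒x∈p-y (p⊆q x∈p) (λ { refl → y∉p x∈p })

∪-delete : ∀ (p q : Subset n) → y ∉ q → (p - y) ∪ q ⊆ (p ∪ q) - y
∪-delete p q y∉q x∈ =
  [ delete-monotone (p⊆p∪q q) , ⊆-delete-absent y∉q (q⊆p∪q p q) ] (x∈p∪q⁻ (p - _) q x∈)

disjoint⇒∉ : Empty (p ∩ q) → x ∈ p → x ∉ q
disjoint⇒∉ disj x∈p x∈q = disj (_ , x∈p∩q⁺ (x∈p , x∈q))

disjoint-shrinkˡ : ∀ (r q : Subset n) → r ⊆ p → Empty (p ∩ q) → Empty (r ∩ q)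
disjoint-shrinkˡ r q r⊆p disj (x , x∈r∩q) =
  disjoint⇒∉ disj (r⊆p (proj₁ (x∈p∩q⁻ r q x∈r∩q))) (proj₂ (x∈p∩q⁻ r q x∈r∩q))

∣p∪q∣≡∣p∣+∣q∣ : ∀ (p q : Subset n) → Empty (p ∩ q) → ∣ p ∪ q ∣ ≡ ∣ p ∣ + ∣ q ∣
∣p∪q∣≡∣p∣+∣q∣ []            []            _    = refl
∣p∪q∣≡∣p∣+∣q∣ (inside ∷ p)  (inside ∷ q)  disj = ⊥-elim (disj (Fin.zero , here))
∣p∪q∣≡∣p∣+∣q∣ (inside ∷ p)  (outside ∷ q) disj = cong suc (∣p∪q∣≡∣p∣+∣q∣ p q (drop-∷-Empty disj))
∣p∪q∣≡∣p∣+∣q∣ (outside ∷ p) (inside ∷ q)  disj =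
  trans (cong suc (∣p∪q∣≡∣p∣+∣q∣ p q (drop-∷-Empty disj))) (sym (+-suc ∣ p ∣ ∣ q ∣))
∣p∪q∣≡∣p∣+∣q∣ (outside ∷ p) (outside ∷ q) disj = ∣p∪q∣≡∣p∣+∣q∣ p q (drop-∷-Empty disj)

Deg : Grid → ℕ → Subset 81 → Set
Deg G n S = UnavoidableOfDegree (suc n) G S

module _ {G : Grid} where

  completion-⊆ : ∀ {S T H} → S ⊆ T →
                 IsCompletionOfComplement G S H → IsCompletionOfComplement G T H
  completion-⊆ S⊆T (solution , agree) = solution , λ c c∉T → agree c (λ c∈S → c∉T (S⊆T c∈S))

  -- An unavoidable set is nonempty: two completions of G ∖ S that differ
  -- somewhere differ at a cell of S.
  unavoidable-nonempty : ∀ n {S} → Deg G n S → Nonempty S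
  unavoidable-nonempty zero {S} (H₁ , H₂ , (_ , H₁≡G) , (_ , H₂≡G) , c , H₁c≢H₂c) with c ∈? S
  ... | yes c∈S = c , c∈S
  ... | no  c∉S = ⊥-elim (H₁c≢H₂c (trans (H₁≡G c c∉S) (sym (H₂≡G c c∉S))))
  unavoidable-nonempty (suc n) (nonempty , _) = nonempty

  superset : ∀ n {S T} → S ⊆ T → Deg G n S → Deg G n T
  lower    : ∀ n {S} → Deg G (suc n) S → Deg G n S

  superset zero S⊆T (H₁ , H₂ , H₁-compl , H₂-compl , differ) =
    H₁ , H₂ , completion-⊆ S⊆T H₁-compl , completion-⊆ S⊆T H₂-compl , differ
  superset (suc n) {S} {T} S⊆T S-deg@((s , s∈S) , delete) =
    (s , S⊆T s∈S) , λ c _ → delete-from-T c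
    where
    -- T - c contains S - c if c ∈ S, and S itself otherwise.
    delete-from-T : ∀ c → Deg G n (T - c)
    delete-from-T c with c ∈? S
    ... | yes c∈S = superset n (delete-monotone S⊆T) (delete c c∈S)
    ... | no  c∉S = superset n (⊆-delete-absent c∉S S⊆T) (lower n S-deg)

  lower zero    {S} ((s , s∈S) , delete) = superset zero (p─q⊆p S ⁅ s ⁆) (delete s s∈S)
  lower (suc n) (nonempty , delete)      = nonempty , λ c c∈S → lower n (delete c c∈S)

  union        : ∀ k ℓ {U V} → Deg G k U → Deg G ℓ V → Empty (U ∩ V) →
                 Deg G (suc (k + ℓ)) (U ∪ V)
  delete-left  : ∀ k ℓ {U V c} → Deg G k U → Deg G ℓ V → Empty (U ∩ V) →
                 c ∈ U → Deg G (k + ℓ) ((U ∪ V) - c)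
  delete-right : ∀ k ℓ {U V c} → Deg G k U → Deg G ℓ V → Empty (U ∩ V) →
                 c ∈ V → Deg G (k + ℓ) ((U ∪ V) - c)

  union k ℓ {U} {V} U-deg V-deg disj =
    nonempty-∪ ,
    λ c c∈U∪V → [ delete-left k ℓ U-deg V-deg disj , delete-right k ℓ U-deg V-deg disj ]
                  (x∈p∪q⁻ U V c∈U∪V)
    where
    nonempty-∪ : Nonempty (U ∪ V)
    nonempty-∪ = let (u , u∈U) = unavoidable-nonempty k U-deg in u , p⊆p∪q V u∈U

  delete-left zero ℓ {U} {V} _ V-deg disj c∈U =
    superset ℓ (⊆-trans (q⊆p∪q (U - _) V) (∪-delete U V (disjoint⇒∉ disj c∈U))) V-deg
  delete-left (suc k) ℓ {U} {V} {c} (_ , delete) V-deg disj c∈U =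
    superset (suc (k + ℓ)) (∪-delete U V (disjoint⇒∉ disj c∈U))
      (union k ℓ (delete c c∈U) V-deg (disjoint-shrinkˡ (U - c) V (p─q⊆p U ⁅ c ⁆) disj))

  delete-right k ℓ {U} {V} {c} U-deg V-deg disj c∈V =
    subst₂ (Deg G) (+-comm ℓ k) (cong (_- c) (∪-comm V U))
      (delete-left ℓ k V-deg U-deg (subst Empty (∩-comm U V) disj) c∈V)

mainTheorem8 : (G : Grid) → IsSolution G →
    (k ℓ m n : ℕ) → 1 ≤ k → 1 ≤ ℓ →
    (U V : Subset 81) →
    UnavoidableOfDegree k G U → ∣ U ∣ ≡ m →
    UnavoidableOfDegree ℓ G V → ∣ V ∣ ≡ n →
    Empty (U ∩ V) →
    UnavoidableOfDegree (k + ℓ) G (U ∪ V) × ∣ U ∪ V ∣ ≡ m + n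
mainTheorem8 G _ (suc k) (suc ℓ) m n (s≤s z≤n) (s≤s z≤n) U V U-deg refl V-deg refl disj =
  subst (λ d → Deg G d (U ∪ V)) (sym (+-suc k ℓ)) (union k ℓ U-deg V-deg disj) ,
  ∣p∪q∣≡∣p∣+∣q∣ U V disj
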